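{- Let $p=3$, $k=2$, $e\ge1$, and $n=3^{l_1}+3^{l_2}+3^{l_3}$ where $l_1,l_2,l_3$ are non-negative integers, exactly one of which is zero. Then $D_{n,2}(1,x)$ is not a permutation polynomial of $\mathbb{F}_{3^e}$.
   Context: For an odd prime $p$ and $0\le k\le p-1$: for $n\ge 1$, $D_{n,k}(1,x)=\sum_{i=0}^{\lfloor n/2\rfloor}\frac{n-ki}{n-i}\binom{n-i}{i}(-x)^i$, where the coefficient is the integer $\binom{n-i}{i}-(k-1)\binom{n-i-1}{i-1}$ (with $\binom{m}{ -1}=0$) viewed in $\mathbb{F}_p$; $D_{0,k}(1,x)=2-k$. Equivalently $D_{1,k}=1$ and $D_{n,k}=D_{n-1,k}-xD_{n-2,k}$ for $n\ge2$. A polynomial over $\mathbb{F}_q$ is a permutation polynomial of $\mathbb{F}_q$ if it induces a bijection of $\mathbb{F}_q$. -}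

module Defs where

open import Level using (Level; _⊔_) renaming (suc to lsuc)
open import Data.Nat using (ℕ; zero; suc)
open import Data.Fin using (Fin)
open import Data.Product using (Σ; ∃; _×_; _,_; proj₁; proj₂)
open import Relation.Nullary using (¬_)
open import Relation.Binary.PropositionalEquality using (_≡_)
open import Algebra.Bundles using (CommutativeRing)

record FiniteField (c ℓ : Level) (q : ℕ) : Set (lsuc (c ⊔ ℓ)) where
  field
    commRing : CommutativeRing c ℓ
  open CommutativeRing commRing public
  field
    1≉0      : ¬ (1# ≈ 0#)
    inverse  : ∀ x → ¬ (x ≈ 0#) → ∃ λ y → (x * y) ≈ 1#
    enum     : Fin q → Carrier
    enum-inj : ∀ i j → enum i ≈ enum j → i ≡ j
    enum-sur : ∀ x → ∃ λ i → enum i ≈ x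

module _ {c ℓ : Level} {q : ℕ} (F : FiniteField c ℓ q) where
  open FiniteField F

  ℕ→F : ℕ → Carrier
  ℕ→F zero    = 0#
  ℕ→F (suc m) = 1# + ℕ→F m

  -- (D_{n+1,k}(1,x) , D_{n,k}(1,x)) evaluated at x
  Dpair : ℕ → ℕ → Carrier → Carrier × Carrier
  Dpair k zero    x = 1# , (ℕ→F 2 - ℕ→F k)
  Dpair k (suc n) x = let (a , b) = Dpair k n x in (a - x * b) , a

  D : ℕ → ℕ → Carrier → Carrier
  D n k x = proj₂ (Dpair k n x)

  IsPermutation : (Carrier → Carrier) → Set (c ⊔ ℓ)
  IsPermutation f = (∀ x y → f x ≈ f y → x ≈ y) × (∀ y → ∃ λ x → f x ≈ y)

-- Idea: such n satisfies n ≡ 1 (mod 6), and for every n ≡ 1 (mod 6) and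
-- every k the function x ↦ D_{n,k}(1,x) takes the value 1 at both x = 0 and
-- x = 1, so it is not injective (1 ≠ 0 in a field).
--
-- At x = 1 the recurrence reads s(n+2) = s(n+1) - s(n); any
--    such sequence in an abelian group satisfies s(n+3) = -s(n), hence has
--    period 6, so D_{6m+1,k}(1,1) = D_{1,k}(1,1) = 1.  At x = 0 the
--    recurrence reads s(n+2) = s(n+1), so D_{n+1,k}(1,0) = D_{1,k}(1,0) = 1.
--  * Arithmetic part.  Residues modulo 6 as explicit witnesses: 3^l ≡ 3 for
--    l ≥ 1, 3^0 ≡ 1, and residues add, so the sum in question is ≡ 7 ≡ 1.
--  * The theorem combines the two.
module Submission where

open import Defs
open import Data.Nat using (ℕ; _+_; _^_; _≥_)
open import Data.Product using (_×_)
open import Data.Sum using (_⊎_)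
open import Relation.Binary.PropositionalEquality using (_≡_; _≢_)
open import Relation.Nullary using (¬_)

open import Level using (Level)
open import Data.Nat using (zero; suc; _*_)
open import Data.Product using (_,_; ∃)
open import Data.Sum using (inj₁; inj₂)
open import Data.Empty using (⊥-elim)
import Relation.Binary.PropositionalEquality as P
open import Data.Nat.Tactic.RingSolver using (solve-∀)

module FieldPart {c ℓ : Level} {q : ℕ} (F : FiniteField c ℓ q) where
  open FiniteField F renaming (_+_ to _⊹_; _*_ to _⋆_)
  open import Algebra.Properties.Group +-group using (⁻¹-involutive; ε⁻¹≈ε)
  open import Relation.Binary.Reasoning.Setoid setoid

  D-recurrence : ∀ n k x → D F (2 + n) k x ≈ D F (1 + n) k x - x ⋆ D F n k x
  D-recurrence n k x = refl

  sub-sub-cancel : ∀ a b → (a - b) - a ≈ - b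
  sub-sub-cancel a b = begin
    (a ⊹ - b) ⊹ - a ≈⟨ +-congʳ (+-comm a (- b)) ⟩
    (- b ⊹ a) ⊹ - a ≈⟨ +-assoc (- b) a (- a) ⟩
    - b ⊹ (a ⊹ - a) ≈⟨ +-congˡ (-‿inverseʳ a) ⟩
    - b ⊹ 0#        ≈⟨ +-identityʳ (- b) ⟩
    - b             ∎

  antiperiodic-3 : (s : ℕ → Carrier) → (∀ n → s (2 + n) ≈ s (1 + n) - s n)
                 → ∀ n → s (3 + n) ≈ - s n
  antiperiodic-3 s rec n = begin
    s (3 + n)                     ≈⟨ rec (1 + n) ⟩
    s (2 + n) - s (1 + n)         ≈⟨ +-congʳ (rec n) ⟩
    (s (1 + n) - s n) - s (1 + n) ≈⟨ sub-sub-cancel (s (1 + n)) (s n) ⟩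
    - s n                         ∎

  periodic-6 : (s : ℕ → Carrier) → (∀ n → s (2 + n) ≈ s (1 + n) - s n)
             → ∀ n → s (6 + n) ≈ s n
  periodic-6 s rec n = begin
    s (6 + n)   ≈⟨ antiperiodic-3 s rec (3 + n) ⟩
    - s (3 + n) ≈⟨ -‿cong (antiperiodic-3 s rec n) ⟩
    - - s n     ≈⟨ ⁻¹-involutive (s n) ⟩
    s n         ∎

  D-at-one : ∀ k m → D F (1 + m * 6) k 1# ≈ 1#
  D-at-one k zero    = refl
  D-at-one k (suc m) =
    trans (periodic-6 (λ n → D F n k 1#) recurrence-at-one (1 + m * 6))
          (D-at-one k m)
    where
    recurrence-at-one : ∀ n → D F (2 + n) k 1# ≈ D F (1 + n) k 1# - D F n k 1#
    recurrence-at-one n =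
      trans (D-recurrence n k 1#) (+-congˡ (-‿cong (*-identityˡ _)))

  -- D_{n+1,k}(1,0) = 1, since at x = 0 the recurrence is D_{n+2} = D_{n+1}.
  D-at-zero : ∀ k n → D F (1 + n) k 0# ≈ 1#
  D-at-zero k zero    = refl
  D-at-zero k (suc n) = begin
    D F (1 + n) k 0# - 0# ⋆ D F n k 0# ≈⟨ +-congˡ (-‿cong (zeroˡ _)) ⟩
    D F (1 + n) k 0# - 0#             ≈⟨ +-congˡ ε⁻¹≈ε ⟩
    D F (1 + n) k 0# ⊹ 0#             ≈⟨ +-identityʳ _ ⟩
    D F (1 + n) k 0#                  ≈⟨ D-at-zero k n ⟩
    1#                                ∎

  not-permutation : ∀ k m → ¬ IsPermutation F (D F (1 + m * 6) k)
  not-permutation k m (injective , _) =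
    1≉0 (injective 1# 0# (trans (D-at-one k m) (sym (D-at-zero k (m * 6)))))

Residue6 : ℕ → ℕ → Set
Residue6 r n = ∃ λ t → n ≡ r + t * 6

residue-+ : ∀ {r s m n} → Residue6 r m → Residue6 s n → Residue6 (r + s) (m + n)
residue-+ {r} {s} (t , P.refl) (u , P.refl) = t + u , sum-identity r s t u
  where
  sum-identity : ∀ r s t u → (r + t * 6) + (s + u * 6) ≡ (r + s) + (t + u) * 6
  sum-identity = solve-∀

residue-reduce : ∀ {r n} → Residue6 (6 + r) n → Residue6 r n
residue-reduce {r} (t , P.refl) = suc t , shift r t
  where
  shift : ∀ r t → (6 + r) + t * 6 ≡ r + suc t * 6
  shift = solve-∀

power-of-three-residue : ∀ l → l ≢ 0 → Residue6 3 (3 ^ l)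
power-of-three-residue zero    l≢0 = ⊥-elim (l≢0 P.refl)
power-of-three-residue (suc l) _   = positive l
  where
  positive : ∀ l → Residue6 3 (3 ^ suc l)
  positive zero    = 0 , P.refl
  positive (suc l) with positive l
  ... | t , eq = suc (t * 3) , P.trans (P.cong (3 *_) eq) (triple t)
    where
    triple : ∀ t → 3 * (3 + t * 6) ≡ 3 + suc (t * 3) * 6
    triple = solve-∀

power-of-three-zero : ∀ l → l ≡ 0 → Residue6 1 (3 ^ l)
power-of-three-zero _ P.refl = 0 , P.refl

exponent-residue : ∀ l₁ l₂ l₃
  → (l₁ ≡ 0 × l₂ ≢ 0 × l₃ ≢ 0) ⊎ (l₁ ≢ 0 × l₂ ≡ 0 × l₃ ≢ 0) ⊎ (l₁ ≢ 0 × l₂ ≢ 0 × l₃ ≡ 0)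
  → Residue6 1 (3 ^ l₁ + 3 ^ l₂ + 3 ^ l₃)
exponent-residue l₁ l₂ l₃ (inj₁ (h₁ , h₂ , h₃)) = residue-reduce
  (residue-+ (residue-+ (power-of-three-zero l₁ h₁) (power-of-three-residue l₂ h₂))
             (power-of-three-residue l₃ h₃))
exponent-residue l₁ l₂ l₃ (inj₂ (inj₁ (h₁ , h₂ , h₃))) = residue-reduce
  (residue-+ (residue-+ (power-of-three-residue l₁ h₁) (power-of-three-zero l₂ h₂))
             (power-of-three-residue l₃ h₃))
exponent-residue l₁ l₂ l₃ (inj₂ (inj₂ (h₁ , h₂ , h₃))) = residue-reduce
  (residue-+ (residue-+ (power-of-three-residue l₁ h₁) (power-of-three-residue l₂ h₂))
             (power-of-three-zero l₃ h₃))

mainTheorem12 : ∀ {c ℓ} (e : ℕ) → e ≥ 1 → (F : FiniteField c ℓ (3 ^ e))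
    → (l₁ l₂ l₃ : ℕ)
    → (l₁ ≡ 0 × l₂ ≢ 0 × l₃ ≢ 0) ⊎ (l₁ ≢ 0 × l₂ ≡ 0 × l₃ ≢ 0) ⊎ (l₁ ≢ 0 × l₂ ≢ 0 × l₃ ≡ 0)
    → ¬ IsPermutation F (D F (3 ^ l₁ + 3 ^ l₂ + 3 ^ l₃) 2)
mainTheorem12 e _ F l₁ l₂ l₃ exactly-one-zero =
  let (m , n≡1+6m) = exponent-residue l₁ l₂ l₃ exactly-one-zero
  in P.subst (λ n → ¬ IsPermutation F (D F n 2)) (P.sym n≡1+6m)
             (FieldPart.not-permutation F 2 m)
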